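{- Let $p$ be a prime, $s\ge 1$ an integer, and let $y,\bar y$ be $p$-adic integers with $\nu_p(y)=0$ and $y\equiv \bar y \pmod{p^s}$. Then for every integer $n\ge 1$, \[G_n(y)\equiv G_n(\bar y)\pmod{p^s},\] and consequently $J_{p^s}(y)=J_{p^s}(\bar y)$.
   Context: For a $p$-adic number (e.g. a rational number) $y$ and an integer $n\ge 1$, define $G_n(y)=\sum_{j=1}^{n}\frac{y^j}{j}$. Here $\nu_p$ denotes the $p$-adic valuation, and for $a,b\in\mathbb{Q}_p$ the congruence $a\equiv b\pmod{p^s}$ means $\nu_p(a-b)\ge s$. For a positive integer $N$, $J_N(y)=\{n\ge 1: G_n(y)\equiv 0 \pmod N\}$. -}

module Defs where

open import Data.Nat as ℕ using (ℕ; zero; suc; _!)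
open import Data.Nat.DivMod using (_/_)
open import Data.Integer as ℤ using (ℤ; +_; 0ℤ)
import Data.Integer.Divisibility as ℤD
import Data.Nat.Divisibility as ℕD
open import Data.Product using (_×_)
open import Data.Empty using (⊥)

-- A p-adic integer, represented by a coherent sequence of integer
-- approximations: digit k ≡ z (mod p^k), with digit (k+1) ≡ digit k (mod p^k).
-- Every such sequence determines a unique element z of ℤ_p and every
-- element of ℤ_p arises this way.
record ℤₚ (p : ℕ) : Set where
  field
    digit : ℕ → ℤ
    coh   : ∀ k → (+ (p ℕ.^ k)) ℤD.∣ (digit (suc k) ℤ.- digit k)
open ℤₚ public

νₚ≥ : {p : ℕ} → ℤₚ p → ℕ → Set
νₚ≥ {p} z m = (+ (p ℕ.^ m)) ℤD.∣ digit z m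

unitₚ : {p : ℕ} → ℤₚ p → Set
unitₚ {p} y = νₚ≥ y 1 → ⊥

_≡ₚ_[mod^_] : {p : ℕ} → ℤₚ p → ℤₚ p → ℕ → Set
_≡ₚ_[mod^_] {p} y y' s = (+ (p ℕ.^ s)) ℤD.∣ (digit y s ℤ.- digit y' s)

Σ< : ℕ → (ℕ → ℤ) → ℤ
Σ< zero    f = 0ℤ
Σ< (suc n) f = Σ< n f ℤ.+ f n

-- Digit sequence of the p-adic integer  n! · G_n(y) = Σ_{j=1}^n (n!/j) y^j
-- (an integer-coefficient polynomial in y, so applying it to the digits of y
-- gives valid approximations mod p^k).
GNum : {p : ℕ} → ℕ → ℤₚ p → ℕ → ℤ
GNum n y k = Σ< n (λ i → (+ ((n !) / suc i)) ℤ.* (digit y k ℤ.^ suc i))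

-- For elements a/D, b/D of ℚ_p with a,b ∈ ℤ_p (given by digit sequences)
-- and D ∈ ℕ nonzero:  a/D ≡ b/D (mod p^s)  ⟺  ν_p(a - b) ≥ s + ν_p(D)
-- ⟺ for every t with p^t ∣ D, ν_p(a - b) ≥ s + t.
ScaledCong : (p s D : ℕ) → (ℕ → ℤ) → (ℕ → ℤ) → Set
ScaledCong p s D a b =
  ∀ t → (p ℕ.^ t) ℕD.∣ D → (+ (p ℕ.^ (s ℕ.+ t))) ℤD.∣ (a (s ℕ.+ t) ℤ.- b (s ℕ.+ t))

GCong : {p : ℕ} → ℕ → ℕ → ℤₚ p → ℤₚ p → Set
GCong {p} s n y y' = ScaledCong p s (n !) (GNum n y) (GNum n y')

-- n ∈ J_{p^s}(y)  ⟺  n ≥ 1 and G_n(y) ≡ 0 (mod p^s)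
J : {p : ℕ} → ℕ → ℤₚ p → ℕ → Set
J {p} s y n = (1 ℕ.≤ n) × ScaledCong p s (n !) (GNum n y) (λ _ → 0ℤ)

{-# OPTIONS --safe #-}
-- The proof works with n! · G_n(y) = Σ_{j ≤ n} (n!/j) y^j.  If p^t ∣ n!, then
-- p^t ∣ (n!/j) · j for every j ≤ n, and the claim reduces to the termwise
-- congruence  c · y^j ≡ c · ȳ^j (mod p^(s+t))  whenever p^t ∣ c · j.  This is
-- proved by induction on t: if p ∤ j then p^t ∣ c already; if j = q p, the
-- lifting step  a ≡ b (mod p^s), s ≥ 1  ⇒  a^p ≡ b^p (mod p^(s+1))  trades one
-- factor p of j for one more power of p in the modulus.
module Submission where

open import Defs
open import Data.Nat using (ℕ; _≥_)
open import Data.Nat.Primality using (Prime)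
open import Data.Product using (_×_)
open import Function.Bundles using (_⇔_)

open import Data.Nat as N using (zero; suc; _!; _<_; NonZero)
open import Data.Nat.DivMod using (_/_; m/n*n≡m)
import Data.Nat.Properties as NP
import Data.Nat.Divisibility as ND
open import Data.Nat.Primality using (euclidsLemma; prime⇒nonZero)
open import Data.Integer as Z using (ℤ; +_; 0ℤ; 1ℤ; _^_)
import Data.Integer.Properties as ZP
open import Data.Integer.Divisibility.Signed as S using (divides)
open import Data.Integer.Solver using (module +-*-Solver)
open +-*-Solver using (solve; _:=_; _:+_; _:-_; _:*_; :-_; con)
open import Data.Product using (_,_)
open import Data.Sum using (inj₁; inj₂)
open import Data.Empty using (⊥-elim)
open import Relation.Nullary using (yes; no; ¬_)
open import Relation.Binary.PropositionalEquality
  using (_≡_; refl; sym; trans; cong; subst; subst₂; module ≡-Reasoning)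
open import Function.Bundles using (mk⇔)
open import Function.Base using (_$_)

infix 4 _≡_[mod_]

record _≡_[mod_] (a b d : ℤ) : Set where
  constructor mk≡-mod
  field ∣-sub : d S.∣ a Z.- b
open _≡_[mod_]

*-distribˡ-- : ∀ c a b → c Z.* (a Z.- b) ≡ c Z.* a Z.- c Z.* b
*-distribˡ-- = solve 3 (λ c a b → c :* (a :- b) := c :* a :- c :* b) refl

module _ {d : ℤ} where

  ≡⇒≡-mod : ∀ {a b} → a ≡ b → a ≡ b [mod d ]
  ≡⇒≡-mod {a} refl = mk≡-mod (subst (d S.∣_) (sym (ZP.+-inverseʳ a)) (divides 0ℤ refl))

  ≡-mod-refl : ∀ a → a ≡ a [mod d ]
  ≡-mod-refl a = ≡⇒≡-mod refl

  ≡-mod-sym : ∀ {a b} → a ≡ b [mod d ] → b ≡ a [mod d ]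
  ≡-mod-sym {a} {b} (mk≡-mod d∣a-b) = mk≡-mod
    (subst (d S.∣_) (solve 2 (λ a b → :- (a :- b) := b :- a) refl a b) (S.∣m⇒∣-m d∣a-b))

  ≡-mod-trans : ∀ {a b c} → a ≡ b [mod d ] → b ≡ c [mod d ] → a ≡ c [mod d ]
  ≡-mod-trans {a} {b} {c} (mk≡-mod d∣a-b) (mk≡-mod d∣b-c) = mk≡-mod
    (subst (d S.∣_) (solve 3 (λ a b c → (a :- b) :+ (b :- c) := a :- c) refl a b c)
      (S.∣m∣n⇒∣m+n d∣a-b d∣b-c))

  ≡-mod-+ : ∀ {a b c e} → a ≡ b [mod d ] → c ≡ e [mod d ] → a Z.+ c ≡ b Z.+ e [mod d ]
  ≡-mod-+ {a} {b} {c} {e} (mk≡-mod d∣a-b) (mk≡-mod d∣c-e) = mk≡-mod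
    (subst (d S.∣_) (solve 4 (λ a b c e → (a :- b) :+ (c :- e) := (a :+ c) :- (b :+ e)) refl a b c e)
      (S.∣m∣n⇒∣m+n d∣a-b d∣c-e))

  ≡-mod-*ˡ : ∀ c {a b} → a ≡ b [mod d ] → c Z.* a ≡ c Z.* b [mod d ]
  ≡-mod-*ˡ c {a} {b} (mk≡-mod d∣a-b) = mk≡-mod
    (subst (d S.∣_) (*-distribˡ-- c a b) (S.∣n⇒∣m*n c d∣a-b))

  ≡-mod-weaken : ∀ {e a b} → d S.∣ e → a ≡ b [mod e ] → a ≡ b [mod d ]
  ≡-mod-weaken d∣e (mk≡-mod e∣a-b) = mk≡-mod (S.∣-trans d∣e e∣a-b)

≡-mod-*ˡ-∣ : ∀ {d e c a b} → e S.∣ c → a ≡ b [mod d ] → c Z.* a ≡ c Z.* b [mod e Z.* d ]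
≡-mod-*ˡ-∣ {d} {e} {c} {a} {b} e∣c (mk≡-mod d∣a-b) = mk≡-mod
  (subst (e Z.* d S.∣_) (*-distribˡ-- c a b)
    (S.∣-trans (S.*-monoʳ-∣ e d∣a-b) (S.*-monoˡ-∣ (a Z.- b) e∣c)))

Σ<-cong-mod : ∀ {d} n {f g : ℕ → ℤ} → (∀ i → i < n → f i ≡ g i [mod d ]) →
              Σ< n f ≡ Σ< n g [mod d ]
Σ<-cong-mod zero    f≡g = ≡-mod-refl 0ℤ
Σ<-cong-mod (suc n) f≡g =
  ≡-mod-+ (Σ<-cong-mod n (λ i i<n → f≡g i (NP.m<n⇒m<1+n i<n))) (f≡g n (NP.n<1+n n))

m<n⇒1+m∣n! : ∀ {m n} → m < n → suc m ND.∣ n !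
m<n⇒1+m∣n! {m} m<n = ND.∣-trans (ND.m∣m*n (m !)) (ND.m≤n⇒m!∣n! m<n)

geomSum : ℤ → ℤ → ℕ → ℤ
geomSum a b zero    = 0ℤ
geomSum a b (suc m) = a ^ m Z.+ b Z.* geomSum a b m

^-sub-factor : ∀ a b m → a ^ m Z.- b ^ m ≡ (a Z.- b) Z.* geomSum a b m
^-sub-factor a b zero    = sym (ZP.*-zeroʳ (a Z.- b))
^-sub-factor a b (suc m) = begin
  a Z.* a ^ m Z.- b Z.* b ^ m
    ≡⟨ solve 4 (λ a b A B → a :* A :- b :* B := (a :- b) :* A :+ b :* (A :- B))
               refl a b (a ^ m) (b ^ m) ⟩
  (a Z.- b) Z.* a ^ m Z.+ b Z.* (a ^ m Z.- b ^ m)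
    ≡⟨ cong (λ x → (a Z.- b) Z.* a ^ m Z.+ b Z.* x) (^-sub-factor a b m) ⟩
  (a Z.- b) Z.* a ^ m Z.+ b Z.* ((a Z.- b) Z.* geomSum a b m)
    ≡⟨ solve 4 (λ a b A G → (a :- b) :* A :+ b :* ((a :- b) :* G) := (a :- b) :* (A :+ b :* G))
               refl a b (a ^ m) (geomSum a b m) ⟩
  (a Z.- b) Z.* geomSum a b (suc m) ∎
  where open ≡-Reasoning

module _ {d a b : ℤ} (a≡b : a ≡ b [mod d ]) where

  ^-cong-mod : ∀ m → a ^ m ≡ b ^ m [mod d ]
  ^-cong-mod m = mk≡-mod
    (subst (d S.∣_) (sym (^-sub-factor a b m)) (S.∣m⇒∣m*n (geomSum a b m) (∣-sub a≡b)))

  geomSum-cong-mod : ∀ m → geomSum a b (suc m) ≡ + suc m Z.* b ^ m [mod d ]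
  geomSum-cong-mod zero    = ≡⇒≡-mod (solve 1 (λ b → con 1ℤ :+ b :* con 0ℤ := con 1ℤ :* con 1ℤ) refl b)
  geomSum-cong-mod (suc m) = ≡-mod-trans
    (≡-mod-+ (^-cong-mod (suc m)) (≡-mod-*ˡ b (geomSum-cong-mod m)))
    (≡⇒≡-mod (solve 3 (λ b B n → b :* B :+ b :* (n :* B) := (con 1ℤ :+ n) :* (b :* B))
                      refl b (b ^ m) (+ suc m)))

geomSum-≡-mod-0 : ∀ q .{{_ : NonZero q}} {a b} → a ≡ b [mod + q ] → geomSum a b q ≡ 0ℤ [mod + q ]
geomSum-≡-mod-0 (suc m) {b = b} a≡b = ≡-mod-trans (geomSum-cong-mod a≡b m)
  (mk≡-mod (subst (+ suc m S.∣_) (sym (ZP.+-identityʳ _)) (S.∣m⇒∣m*n (b ^ m) S.∣-refl)))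

module _ (p : ℕ) (p-prime : Prime p) where
  instance
    p-nonZero : NonZero p
    p-nonZero = prime⇒nonZero p-prime

  P : ℕ → ℤ
  P k = + (p N.^ k)

  P-+ : ∀ s t → P (s N.+ t) ≡ P s Z.* P t
  P-+ s t = trans (cong +_ (NP.^-distribˡ-+-* p s t)) (ZP.pos-* (p N.^ s) (p N.^ t))

  P∣P-+ : ∀ s t → P s S.∣ P (s N.+ t)
  P∣P-+ s t = divides (P t) (trans (P-+ s t) (ZP.*-comm (P s) (P t)))

  P-suc : ∀ s → P (suc s) ≡ P s Z.* + p
  P-suc s = trans (cong +_ (NP.*-comm p (p N.^ s))) (ZP.pos-* (p N.^ s) p)

  p∣P : ∀ {s} → s ≥ 1 → + p S.∣ P s
  p∣P {suc s} _ = divides (P s) (P-suc s)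

  ^p-lift : ∀ {s a b} → s ≥ 1 → a ≡ b [mod P s ] → a ^ p ≡ b ^ p [mod P (suc s) ]
  ^p-lift {s} {a} {b} s≥1 a≡b =
    mk≡-mod $ subst₂ S._∣_ (sym (P-suc s)) (sym (^-sub-factor a b p))
      (S.∣-trans (S.*-monoˡ-∣ (+ p) (∣-sub a≡b)) (S.*-monoʳ-∣ (a Z.- b) p∣geomSum))
    where
    p∣geomSum : + p S.∣ geomSum a b p
    p∣geomSum = subst (+ p S.∣_) (ZP.+-identityʳ _)
      (∣-sub (geomSum-≡-mod-0 p (≡-mod-weaken (p∣P s≥1) a≡b)))

  p^∣m*n⇒p^∣m : ∀ t {c j} → ¬ p ND.∣ j → (p N.^ t) ND.∣ c N.* j → (p N.^ t) ND.∣ c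
  p^∣m*n⇒p^∣m zero    {c}     p∤j _ = ND.1∣ c
  p^∣m*n⇒p^∣m (suc t) {c} {j} p∤j p^t∣cj
    with euclidsLemma c j p-prime (ND.∣-trans (ND.m∣m*n (p N.^ t)) p^t∣cj)
  ... | inj₂ p∣j = ⊥-elim (p∤j p∣j)
  ... | inj₁ (ND.divides c' refl) =
    subst (p N.^ suc t ND.∣_) (NP.*-comm p c')
      (ND.*-monoʳ-∣ p (p^∣m*n⇒p^∣m t p∤j
        (ND.*-cancelˡ-∣ p (subst (p N.^ suc t ND.∣_) rearrange p^t∣cj))))
    where
    rearrange : c' N.* p N.* j ≡ p N.* (c' N.* j)
    rearrange = trans (cong (N._* j) (NP.*-comm c' p)) (NP.*-assoc p c' j)

  *-^-cong-mod : ∀ t {s a b} → s ≥ 1 → a ≡ b [mod P s ] → ∀ c j → (p N.^ t) ND.∣ c N.* j →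
                 + c Z.* a ^ j ≡ + c Z.* b ^ j [mod P (s N.+ t) ]
  *-^-cong-mod zero {s} {a} {b} s≥1 a≡b c j _ =
    subst (λ k → + c Z.* a ^ j ≡ + c Z.* b ^ j [mod P k ]) (sym (NP.+-identityʳ s))
      (≡-mod-*ˡ (+ c) (^-cong-mod a≡b j))
  *-^-cong-mod (suc t) {s} {a} {b} s≥1 a≡b c j p^t∣cj with p ND.∣? j
  ... | no p∤j =
    subst (λ k → + c Z.* a ^ j ≡ + c Z.* b ^ j [mod k ])
      (trans (ZP.*-comm (P (suc t)) (P s)) (sym (P-+ s (suc t))))
      (≡-mod-*ˡ-∣ (S.∣ᵤ⇒∣ {P (suc t)} {+ c} (p^∣m*n⇒p^∣m (suc t) p∤j p^t∣cj)) (^-cong-mod a≡b j))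
  ... | yes (ND.divides q refl) =
    subst (λ k → + c Z.* a ^ (q N.* p) ≡ + c Z.* b ^ (q N.* p) [mod P k ]) (sym (NP.+-suc s t))
      (subst₂ (λ u v → + c Z.* u ≡ + c Z.* v [mod P (suc s N.+ t) ]) (^-^ a) (^-^ b)
        (*-^-cong-mod t {suc s} (N.s≤s N.z≤n) (^p-lift s≥1 a≡b) c q p^t∣cq))
    where
    ^-^ : ∀ x → (x ^ p) ^ q ≡ x ^ (q N.* p)
    ^-^ x = trans (ZP.^-*-assoc x p q) (cong (x ^_) (NP.*-comm p q))
    p^t∣cq : (p N.^ t) ND.∣ c N.* q
    p^t∣cq = ND.*-cancelˡ-∣ p (subst (p N.^ suc t ND.∣_) rearrange p^t∣cj)
      where
      rearrange : c N.* (q N.* p) ≡ p N.* (c N.* q)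
      rearrange = trans (sym (NP.*-assoc c q p)) (NP.*-comm (c N.* q) p)

  digit-≡-mod : (z : ℤₚ p) → ∀ k m → digit z (k N.+ m) ≡ digit z k [mod P k ]
  digit-≡-mod z k zero    rewrite NP.+-identityʳ k = ≡-mod-refl (digit z k)
  digit-≡-mod z k (suc m) rewrite NP.+-suc k m =
    ≡-mod-trans (≡-mod-weaken (P∣P-+ k m) (mk≡-mod (S.∣ᵤ⇒∣ (coh z (k N.+ m)))))
                (digit-≡-mod z k m)

  ≡ₚ⇒digit-≡-mod : ∀ {s} {y y' : ℤₚ p} → y ≡ₚ y' [mod^ s ] →
                   ∀ t → digit y (s N.+ t) ≡ digit y' (s N.+ t) [mod P s ]
  ≡ₚ⇒digit-≡-mod {s} {y} {y'} y≡y' t =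
    ≡-mod-trans (digit-≡-mod y s t)
      (≡-mod-trans (mk≡-mod (S.∣ᵤ⇒∣ y≡y')) (≡-mod-sym (digit-≡-mod y' s t)))

  GNum-cong-mod : ∀ {s} → s ≥ 1 → ∀ {a b} → a ≡ b [mod P s ] → ∀ n t → p N.^ t ND.∣ n ! →
                  Σ< n (λ i → + (n ! / suc i) Z.* a ^ suc i)
                    ≡ Σ< n (λ i → + (n ! / suc i) Z.* b ^ suc i) [mod P (s N.+ t) ]
  GNum-cong-mod s≥1 a≡b n t p^t∣n! = Σ<-cong-mod n λ i i<n →
    *-^-cong-mod t s≥1 a≡b (n ! / suc i) (suc i)
      (subst (p N.^ t ND.∣_) (sym (m/n*n≡m (m<n⇒1+m∣n! i<n))) p^t∣n!)

  GNum-congruence : ∀ {s} → s ≥ 1 → {y y' : ℤₚ p} → y ≡ₚ y' [mod^ s ] → ∀ n → GCong s n y y'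
  GNum-congruence {s} s≥1 {y} {y'} y≡y' n t p^t∣n! =
    S.∣⇒∣ᵤ (∣-sub (GNum-cong-mod s≥1 (≡ₚ⇒digit-≡-mod {s} {y} {y'} y≡y' t) n t p^t∣n!))

module _ {p s D : ℕ} where

  ScaledCong-sym : ∀ a b → ScaledCong p s D a b → ScaledCong p s D b a
  ScaledCong-sym a b a≡b t p^t∣D = S.∣⇒∣ᵤ (∣-sub
    (≡-mod-sym {+ (p N.^ (s N.+ t))} {a (s N.+ t)} {b (s N.+ t)}
      (mk≡-mod (S.∣ᵤ⇒∣ (a≡b t p^t∣D)))))

  ScaledCong-trans : ∀ a b c → ScaledCong p s D a b → ScaledCong p s D b c →
                     ScaledCong p s D a c
  ScaledCong-trans a b c a≡b b≡c t p^t∣D = S.∣⇒∣ᵤ (∣-sub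
    (≡-mod-trans {+ (p N.^ (s N.+ t))} {a (s N.+ t)} {b (s N.+ t)}
      (mk≡-mod (S.∣ᵤ⇒∣ (a≡b t p^t∣D))) (mk≡-mod (S.∣ᵤ⇒∣ (b≡c t p^t∣D)))))

J-transport : ∀ {p} s n (y y' : ℤₚ p) → GCong s n y y' → J s y n → J s y' n
J-transport s n y y' Gy≡Gy' (n≥1 , Gy≡0) =
  n≥1 , ScaledCong-trans (GNum n y') (GNum n y) (λ _ → 0ℤ)
          (ScaledCong-sym (GNum n y) (GNum n y') Gy≡Gy') Gy≡0

proposition1 : (p : ℕ) → Prime p → (s : ℕ) → s ≥ 1 → (y y' : ℤₚ p) →
    unitₚ y → y ≡ₚ y' [mod^ s ] →
    ((n : ℕ) → n ≥ 1 → GCong s n y y') × ((n : ℕ) → J s y n ⇔ J s y' n)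
proposition1 p p-prime s s≥1 y y' _ y≡y' =
  (λ n _ → G-cong n) ,
  λ n → mk⇔ (J-transport s n y y' (G-cong n))
            (J-transport s n y' y (ScaledCong-sym (GNum n y) (GNum n y') (G-cong n)))
  where
  G-cong : ∀ n → GCong s n y y'
  G-cong = GNum-congruence p p-prime {s} s≥1 {y} {y'} y≡y'
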